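{- Let $I$ be an index set. Every $\mathcal{L}_{\mathrm{PA}}(I)$-structure $\mathscr{M}$ that interprets formulas by substitution satisfies the axioms of Peano arithmetic for $\mathcal{L}_{\mathrm{PA}}(I)$.
   Context: Base logic: first-order logic extended by unary operators $\Box$ (formulas $\Box\phi$, $\mathrm{FV}(\Box\phi)=\mathrm{FV}(\phi)$); a structure additionally assigns a truth value $\mathscr{M}\models\Box\phi[s]$ to each operator, formula and assignment, independent of $s(x)$ for $x\notin\mathrm{FV}(\phi)$, invariant under alphabetic variants, and respecting variable substitution. $\mathcal{L}_{\mathrm{PA}}(I)$ is the language of arithmetic ($0,S,+,\cdot$) plus operators $\Box_i$, $i\in I$. Numerals: $\overline{0}=0$, $\overline{n+1}=S(\overline{n})$; $\phi^s$ is $\phi$ with each free variable $x$ replaced by $\overline{s(x)}$. A structure interprets formulas by substitution if it has universe $\mathbb{N}$, interprets $0,S,+,\cdot$ as intended, and for every formula $\phi$ and assignment $s$, $\mathscr{M}\models\phi[s]$ iff $\mathscr{M}\models\phi^s$. The axioms of Peano arithmetic for $\mathcal{L}_{\mathrm{PA}}(I)$ are the usual Peano axioms with the induction schema (universal closures of $\phi(x|0)\rightarrow\forall x(\phi\rightarrow\phi(x|S(x)))\rightarrow\forall x\phi$) extended to all $\mathcal{L}_{\mathrm{PA}}(I)$-formulas $\phi$. -}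

module Defs where

open import Data.Nat using (ℕ; zero; suc; _+_; _*_; _≡ᵇ_)
open import Data.Bool using (Bool; true; false; if_then_else_; T)
open import Data.List using (List; []; _∷_; _++_; foldr)
open import Data.Maybe using (Maybe; just; nothing)
open import Data.Product using (_×_; _,_)
open import Data.Sum using (_⊎_)
open import Data.Empty using (⊥)
open import Data.Unit using (⊤)
open import Relation.Binary.PropositionalEquality using (_≡_; _≢_)
open import Function.Bundles using (_⇔_)

Var : Set
Var = ℕ

data Term : Set where
  var  : Var → Term
  `0   : Term
  S    : Term → Term
  _⊕_  : Term → Term → Term
  _⊗_  : Term → Term → Term

data Formula (I : Set) : Set where
  _≐_  : Term → Term → Formula I
  ⊥'   : Formula I
  _⇒_  : Formula I → Formula I → Formula I
  ∀'   : Var → Formula I → Formula I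
  □    : I → Formula I → Formula I

infix  7 _≐_
infixr 5 _⇒_

¬' : ∀ {I} → Formula I → Formula I
¬' φ = φ ⇒ ⊥'

FreeT : Var → Term → Set
FreeT x (var y) = x ≡ y
FreeT x `0 = ⊥
FreeT x (S t) = FreeT x t
FreeT x (t ⊕ u) = FreeT x t ⊎ FreeT x u
FreeT x (t ⊗ u) = FreeT x t ⊎ FreeT x u

Free : ∀ {I} → Var → Formula I → Set
Free x (t ≐ u) = FreeT x t ⊎ FreeT x u
Free x ⊥' = ⊥
Free x (φ ⇒ ψ) = Free x φ ⊎ Free x ψ
Free x (∀' y φ) = (x ≢ y) × Free x φ
Free x (□ i φ) = Free x φ

fvT : Term → List Var
fvT (var y) = y ∷ []
fvT `0 = []
fvT (S t) = fvT t
fvT (t ⊕ u) = fvT t ++ fvT u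
fvT (t ⊗ u) = fvT t ++ fvT u

remove : Var → List Var → List Var
remove x [] = []
remove x (y ∷ ys) = if y ≡ᵇ x then remove x ys else y ∷ remove x ys

fv : ∀ {I} → Formula I → List Var
fv (t ≐ u) = fvT t ++ fvT u
fv ⊥' = []
fv (φ ⇒ ψ) = fv φ ++ fv ψ
fv (∀' y φ) = remove y (fv φ)
fv (□ i φ) = fv φ

closure : ∀ {I} → Formula I → Formula I
closure φ = foldr ∀' φ (fv φ)

-- Not capture-avoiding; it is only applied where no capture can occur
-- (closed terms, S(x) for x, or variables y substitutable for x).

Subst : Set
Subst = Var → Term

update : {A : Set} → (Var → A) → Var → A → (Var → A)
update s x a y = if y ≡ᵇ x then a else s y

substT : Subst → Term → Term
substT ρ (var y) = ρ y
substT ρ `0 = `0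
substT ρ (S t) = S (substT ρ t)
substT ρ (t ⊕ u) = substT ρ t ⊕ substT ρ u
substT ρ (t ⊗ u) = substT ρ t ⊗ substT ρ u

substF : ∀ {I} → Subst → Formula I → Formula I
substF ρ (t ≐ u) = substT ρ t ≐ substT ρ u
substF ρ ⊥' = ⊥'
substF ρ (φ ⇒ ψ) = substF ρ φ ⇒ substF ρ ψ
substF ρ (∀' y φ) = ∀' y (substF (update ρ y (var y)) φ)
substF ρ (□ i φ) = □ i (substF ρ φ)

_[_∣_] : ∀ {I} → Formula I → Var → Term → Formula I
φ [ x ∣ t ] = substF (update var x t) φ

num : ℕ → Term
num zero = `0
num (suc n) = S (num n)

_^_ : ∀ {I} → Formula I → (Var → ℕ) → Formula I
φ ^ s = substF (λ x → num (s x)) φ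

FreeFor : ∀ {I} → Var → Var → Formula I → Set
FreeFor y x (t ≐ u) = ⊤
FreeFor y x ⊥' = ⊤
FreeFor y x (φ ⇒ ψ) = FreeFor y x φ × FreeFor y x ψ
FreeFor y x (∀' z φ) = (Free x (∀' z φ) → ⊥) ⊎ ((z ≢ y) × FreeFor y x φ)
FreeFor y x (□ i φ) = FreeFor y x φ

-- Alphabetic variants, via translation to a locally nameless form:
-- bound variables become indices, free variables keep their names.

data DTerm : Set where
  fvar  : Var → DTerm
  bvar  : ℕ → DTerm
  d0    : DTerm
  dS    : DTerm → DTerm
  dplus : DTerm → DTerm → DTerm
  dtimes : DTerm → DTerm → DTerm

data DFormula (I : Set) : Set where
  deq  : DTerm → DTerm → DFormula I
  dbot : DFormula I
  dimp : DFormula I → DFormula I → DFormula I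
  dall : DFormula I → DFormula I
  dbox : I → DFormula I → DFormula I

lookupVar : List Var → Var → Maybe ℕ
lookupVar [] x = nothing
lookupVar (y ∷ ys) x with y ≡ᵇ x
... | true = just zero
... | false with lookupVar ys x
...   | just k = just (suc k)
...   | nothing = nothing

dbT : List Var → Term → DTerm
dbT Γ (var x) with lookupVar Γ x
... | just k = bvar k
... | nothing = fvar x
dbT Γ `0 = d0
dbT Γ (S t) = dS (dbT Γ t)
dbT Γ (t ⊕ u) = dplus (dbT Γ t) (dbT Γ u)
dbT Γ (t ⊗ u) = dtimes (dbT Γ t) (dbT Γ u)

dbF : ∀ {I} → List Var → Formula I → DFormula I
dbF Γ (t ≐ u) = deq (dbT Γ t) (dbT Γ u)
dbF Γ ⊥' = dbot
dbF Γ (φ ⇒ ψ) = dimp (dbF Γ φ) (dbF Γ ψ)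
dbF Γ (∀' y φ) = dall (dbF (y ∷ Γ) φ)
dbF Γ (□ i φ) = dbox i (dbF Γ φ)

AlphabeticVariants : ∀ {I} → Formula I → Formula I → Set
AlphabeticVariants φ ψ = dbF [] φ ≡ dbF [] ψ

Assignment : Set → Set
Assignment M = Var → M

record Structure (I : Set) (M : Set) : Set where
  field
    zeroᴹ : M
    sucᴹ  : M → M
    addᴹ  : M → M → M
    mulᴹ  : M → M → M
    box   : I → Formula I → Assignment M → Bool
    box-free  : ∀ i φ (s s' : Assignment M) →
                (∀ x → Free x φ → s x ≡ s' x) → box i φ s ≡ box i φ s'
    box-alpha : ∀ i φ ψ (s : Assignment M) →
                AlphabeticVariants φ ψ → box i φ s ≡ box i ψ s
    box-subst : ∀ i φ x y (s : Assignment M) → FreeFor y x φ →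
                box i (φ [ x ∣ var y ]) s ≡ box i φ (update s x (s y))

module _ {I M : Set} (𝓜 : Structure I M) where
  open Structure 𝓜

  evalT : Assignment M → Term → M
  evalT s (var x) = s x
  evalT s `0 = zeroᴹ
  evalT s (S t) = sucᴹ (evalT s t)
  evalT s (t ⊕ u) = addᴹ (evalT s t) (evalT s u)
  evalT s (t ⊗ u) = mulᴹ (evalT s t) (evalT s u)

  _⊨_[_] : Formula I → Assignment M → Set
  _⊨_[_] (t ≐ u) s = evalT s t ≡ evalT s u
  _⊨_[_] ⊥' s = ⊥
  _⊨_[_] (φ ⇒ ψ) s = _⊨_[_] φ s → _⊨_[_] ψ s
  _⊨_[_] (∀' x φ) s = (a : M) → _⊨_[_] φ (update s x a)
  _⊨_[_] (□ i φ) s = T (box i φ s)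

  _⊨_ : Formula I → Set
  _⊨_ φ = ∀ s → _⊨_[_] φ s

Sat : ∀ {I M} → Structure I M → Formula I → Assignment M → Set
Sat 𝓜 φ s = _⊨_[_] 𝓜 φ s

True : ∀ {I M} → Structure I M → Formula I → Set
True 𝓜 φ = _⊨_ 𝓜 φ

record InterpretsBySubstitution {I : Set} (𝓜 : Structure I ℕ) : Set where
  open Structure 𝓜
  field
    zero-std : zeroᴹ ≡ zero
    suc-std  : ∀ n → sucᴹ n ≡ suc n
    add-std  : ∀ m n → addᴹ m n ≡ m + n
    mul-std  : ∀ m n → mulᴹ m n ≡ m * n
    by-subst : ∀ (φ : Formula I) (s : Assignment ℕ) → Sat 𝓜 φ s ⇔ True 𝓜 (φ ^ s)

x₀ y₀ : Var
x₀ = 0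
y₀ = 1

data PAAxiom (I : Set) : Formula I → Set where
  ax-S≢0   : PAAxiom I (∀' x₀ (¬' (S (var x₀) ≐ `0)))
  ax-S-inj : PAAxiom I (∀' x₀ (∀' y₀ (S (var x₀) ≐ S (var y₀) ⇒ var x₀ ≐ var y₀)))
  ax-+0    : PAAxiom I (∀' x₀ ((var x₀ ⊕ `0) ≐ var x₀))
  ax-+S    : PAAxiom I (∀' x₀ (∀' y₀ ((var x₀ ⊕ S (var y₀)) ≐ S (var x₀ ⊕ var y₀))))
  ax-·0    : PAAxiom I (∀' x₀ ((var x₀ ⊗ `0) ≐ `0))
  ax-·S    : PAAxiom I (∀' x₀ (∀' y₀ ((var x₀ ⊗ S (var y₀)) ≐ ((var x₀ ⊗ var y₀) ⊕ var x₀))))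
  ax-ind   : (φ : Formula I) (x : Var) →
             PAAxiom I (closure (φ [ x ∣ `0 ] ⇒ ∀' x (φ ⇒ φ [ x ∣ S (var x) ]) ⇒ ∀' x φ))

-- In a structure that interprets formulas by substitution, truth of φ under an
-- assignment s is truth of the closed instance φ^s.  The arithmetic axioms then
-- hold because 0, S, +, · are standard.  For induction the key syntactic fact is
-- that (φ(x|t))^s is φ^s' with s' the update of s at x by the value of t (for
-- t = 0 and t = S(x), whose only variable is x, no capture can occur), so the
-- premises of an induction axiom become the premises of ordinary induction on ℕ.
{-# OPTIONS --safe #-}
module Submission where

open import Defs
open import Data.Nat using (ℕ; zero; suc; _+_; _*_; _≡ᵇ_)
open import Data.Nat.Properties
  using (≡ᵇ⇒≡; ≡⇒≡ᵇ; _≟_; suc-injective; +-identityʳ; +-suc; *-zeroʳ; *-suc; +-comm)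
open import Data.Bool using (true; false)
open import Data.Bool.Properties using (T-≡)
open import Data.List using ([]; _∷_; foldr)
open import Data.Sum using (inj₁; inj₂)
open import Relation.Nullary using (yes; no; contradiction)
open import Relation.Binary.PropositionalEquality
open import Function using (_∘′_)
open import Function.Bundles using (Equivalence)
open InterpretsBySubstitution using (zero-std; suc-std; add-std; mul-std; by-subst)

update-same : ∀ {A : Set} (s : Var → A) x a → update s x a x ≡ a
update-same s x a rewrite Equivalence.to T-≡ (≡⇒≡ᵇ x x refl) = refl

update-other : ∀ {A : Set} (s : Var → A) {x y} a → y ≢ x → update s x a y ≡ s y
update-other s {x} {y} a y≢x with y ≡ᵇ x | ≡ᵇ⇒≡ y x
... | true  | y≡x = contradiction (y≡x _) y≢x
... | false | _   = refl

substT-cong : ∀ {σ σ′} t → (∀ w → FreeT w t → σ w ≡ σ′ w) → substT σ t ≡ substT σ′ t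
substT-cong (var y) eq = eq y refl
substT-cong `0      eq = refl
substT-cong (S t)   eq = cong S (substT-cong t eq)
substT-cong (t ⊕ u) eq =
  cong₂ _⊕_ (substT-cong t (λ w → eq w ∘′ inj₁)) (substT-cong u (λ w → eq w ∘′ inj₂))
substT-cong (t ⊗ u) eq =
  cong₂ _⊗_ (substT-cong t (λ w → eq w ∘′ inj₁)) (substT-cong u (λ w → eq w ∘′ inj₂))

Local : Subst → Set
Local ρ = ∀ z w → FreeT w (ρ z) → w ≡ z

Local-update-var : ∀ {ρ} y → Local ρ → Local (update ρ y (var y))
Local-update-var {ρ} y local z w with z ≟ y
... | yes refl rewrite update-same ρ z (var z) = λ w≡z → w≡z
... | no z≢y   rewrite update-other ρ (var y) z≢y = local z w

Local-update-id : ∀ x {t} → (∀ w → FreeT w t → w ≡ x) → Local (update var x t)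
Local-update-id x {t} t-local z w with z ≟ x
... | yes refl rewrite update-same var z t = t-local w
... | no z≢x   rewrite update-other var t z≢x = λ w≡z → w≡z

substT-∘ : ∀ {ρ σ τ} t → (∀ z → substT σ (ρ z) ≡ τ z) → substT σ (substT ρ t) ≡ substT τ t
substT-∘ (var y) eq = eq y
substT-∘ `0      eq = refl
substT-∘ (S t)   eq = cong S (substT-∘ t eq)
substT-∘ (t ⊕ u) eq = cong₂ _⊕_ (substT-∘ t eq) (substT-∘ u eq)
substT-∘ (t ⊗ u) eq = cong₂ _⊗_ (substT-∘ t eq) (substT-∘ u eq)

-- Locality is what rules out capture: below a binder ∀' y, the variable y is
-- never introduced by ρ z for z ≢ y.
substF-∘ : ∀ {I} (φ : Formula I) {ρ σ τ} → Local ρ → (∀ z → substT σ (ρ z) ≡ τ z) →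
           substF σ (substF ρ φ) ≡ substF τ φ
substF-∘ (t ≐ u) local eq = cong₂ _≐_ (substT-∘ t eq) (substT-∘ u eq)
substF-∘ ⊥'      local eq = refl
substF-∘ (φ ⇒ ψ) local eq = cong₂ _⇒_ (substF-∘ φ local eq) (substF-∘ ψ local eq)
substF-∘ (□ i φ) local eq = cong (□ i) (substF-∘ φ local eq)
substF-∘ (∀' y φ) {ρ} {σ} {τ} local eq =
  cong (∀' y) (substF-∘ φ (Local-update-var y local) eq-under-binder)
  where
  eq-under-binder : ∀ z → substT (update σ y (var y)) (update ρ y (var y) z) ≡ update τ y (var y) z
  eq-under-binder z with z ≟ y
  ... | yes refl rewrite update-same ρ z (var z) | update-same τ z (var z) = update-same σ z (var z)
  ... | no z≢y rewrite update-other ρ (var y) z≢y | update-other τ (var y) z≢y =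
    trans (substT-cong (ρ z) (λ w w∈ρz → update-other σ (var y) (λ { refl → z≢y (sym (local z w w∈ρz)) })))
          (eq z)

[∣]-^ : ∀ {I} (φ : Formula I) {x t} (s s′ : Assignment ℕ) → (∀ w → FreeT w t → w ≡ x) →
        substT (λ y → num (s y)) t ≡ num (s′ x) → (∀ z → z ≢ x → s z ≡ s′ z) →
        (φ [ x ∣ t ]) ^ s ≡ φ ^ s′
[∣]-^ φ {x} {t} s s′ t-local t-value s≈s′ = substF-∘ φ (Local-update-id x t-local) numerals-agree
  where
  numerals-agree : ∀ z → substT (λ y → num (s y)) (update var x t z) ≡ num (s′ z)
  numerals-agree z with z ≟ x
  ... | yes refl rewrite update-same var z t = t-value
  ... | no z≢x   rewrite update-other var t z≢x = cong num (s≈s′ z z≢x)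

generalisation : ∀ {I M} (𝓜 : Structure I M) {ψ} → True 𝓜 ψ → ∀ xs → True 𝓜 (foldr ∀' ψ xs)
generalisation 𝓜 ψ-true []       s   = ψ-true s
generalisation 𝓜 ψ-true (x ∷ xs) s a = generalisation 𝓜 ψ-true xs (update s x a)

True-closure : ∀ {I M} (𝓜 : Structure I M) ψ → True 𝓜 ψ → True 𝓜 (closure ψ)
True-closure 𝓜 ψ ψ-true = generalisation 𝓜 ψ-true (fv ψ)

InductionInstance : ∀ {I} → Formula I → Var → Formula I
InductionInstance φ x = φ [ x ∣ `0 ] ⇒ ∀' x (φ ⇒ φ [ x ∣ S (var x) ]) ⇒ ∀' x φ

module _ {I : Set} {𝓜 : Structure I ℕ} (std : InterpretsBySubstitution 𝓜) where
  Sat-transport : ∀ {φ ψ s s′} → φ ^ s ≡ ψ ^ s′ → Sat 𝓜 φ s → Sat 𝓜 ψ s′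
  Sat-transport {φ} {ψ} {s} {s′} eq =
    Equivalence.from (by-subst std ψ s′) ∘′ subst (True 𝓜) eq ∘′ Equivalence.to (by-subst std φ s)

  InductionInstance-valid : ∀ φ x → True 𝓜 (InductionInstance φ x)
  InductionInstance-valid φ x s base step = go
    where
    base-instance : (φ [ x ∣ `0 ]) ^ s ≡ φ ^ update s x 0
    base-instance = [∣]-^ φ s (update s x 0) (λ _ ()) (sym (cong num (update-same s x 0)))
                      (λ z z≢x → sym (update-other s 0 z≢x))

    step-instance : ∀ n → (φ [ x ∣ S (var x) ]) ^ update s x n ≡ φ ^ update s x (suc n)
    step-instance n = [∣]-^ φ (update s x n) (update s x (suc n)) (λ _ w≡x → w≡x) successor
                        (λ z z≢x → trans (update-other s n z≢x) (sym (update-other s (suc n) z≢x)))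
      where
      successor : S (num (update s x n x)) ≡ num (update s x (suc n) x)
      successor rewrite update-same s x n | update-same s x (suc n) = refl

    go : ∀ n → Sat 𝓜 φ (update s x n)
    go zero    = Sat-transport base-instance base
    go (suc n) = Sat-transport (step-instance n) (step n (go n))

lemma2p10 : (I : Set) (𝓜 : Structure I ℕ) → InterpretsBySubstitution 𝓜 →
    (φ : Formula I) → PAAxiom I φ → True 𝓜 φ
lemma2p10 I 𝓜 std _ ax-S≢0 s a
  rewrite suc-std std a | zero-std std = λ ()
lemma2p10 I 𝓜 std _ ax-S-inj s a b
  rewrite suc-std std a | suc-std std b = suc-injective
lemma2p10 I 𝓜 std _ ax-+0 s a
  rewrite zero-std std | add-std std a zero = +-identityʳ a
lemma2p10 I 𝓜 std _ ax-+S s a b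
  rewrite suc-std std b | add-std std a (suc b) | add-std std a b | suc-std std (a + b) = +-suc a b
lemma2p10 I 𝓜 std _ ax-·0 s a
  rewrite zero-std std | mul-std std a zero = *-zeroʳ a
lemma2p10 I 𝓜 std _ ax-·S s a b
  rewrite suc-std std b | mul-std std a (suc b) | mul-std std a b | add-std std (a * b) a =
    trans (*-suc a b) (+-comm a (a * b))
lemma2p10 I 𝓜 std _ (ax-ind φ x) = True-closure 𝓜 (InductionInstance φ x) (InductionInstance-valid std φ x)
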